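{- Let $n=2^\ell$ and let $S=\{u_1,\dots,u_m\}\subseteq\mathbb F_2^d\setminus\{0\}$ be a set of $m$ distinct nonzero vectors. Let $h:\mathbb F_2^d\to\mathbb F_2^\ell$ be a uniformly random linear map. Fix $y\in\mathbb F_2^\ell$ and define $Z_y:=|\{i:h(u_i)=y\}|$. Let $\lambda=m/n$. Then for every integer $r\ge0$, setting $a:=\lceil\log(r+2)\rceil$, \[ \Pr[Z_y>r]\le \lambda^a\left(\prod_{j=0}^{a-1}(r+2-2^j)\right)^{ -1}. \]
   Context: $\log$ is base $2$. A uniformly random linear map is chosen uniformly among all $\mathbb F_2$-linear maps $\mathbb F_2^d\to\mathbb F_2^\ell$. -}

module Defs where

open import Data.Nat using (ℕ; zero; suc; _+_; _*_; _∸_; _^_; _<?_)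
open import Data.Bool using (Bool; true; false; _∧_; _xor_)
import Data.Bool as B
open import Data.Vec using (Vec; []; _∷_; zipWith; foldr; replicate)
import Data.Vec as V
open import Data.Vec.Properties using (≡-dec)
open import Data.List using (List; []; _∷_; concatMap; filter; length; map)

allVecsOf : {A : Set} → List A → (n : ℕ) → List (Vec A n)
allVecsOf xs zero = [] ∷ []
allVecsOf xs (suc n) = concatMap (λ v → map (λ x → x ∷ v) xs) (allVecsOf xs n)

-- F₂ represented by Bool (false = 0, true = 1; xor = +, ∧ = ·)
F2Vec : ℕ → Set
F2Vec n = Vec Bool n

allF2Vecs : (n : ℕ) → List (F2Vec n)
allF2Vecs n = allVecsOf (false ∷ true ∷ []) n

-- A linear map F₂^d → F₂^ℓ, represented by its ℓ × d matrix (list of ℓ rows)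
LinMap : ℕ → ℕ → Set
LinMap d ℓ = Vec (F2Vec d) ℓ

-- All linear maps F₂^d → F₂^ℓ (each exactly once); uniform distribution = uniform over this list
allLinMaps : (d ℓ : ℕ) → List (LinMap d ℓ)
allLinMaps d ℓ = allVecsOf (allF2Vecs d) ℓ

dot : {d : ℕ} → F2Vec d → F2Vec d → Bool
dot u v = foldr _ _xor_ false (zipWith _∧_ u v)

apply : {d ℓ : ℕ} → LinMap d ℓ → F2Vec d → F2Vec ℓ
apply M u = V.map (λ row → dot row u) M

_≟v_ : {n : ℕ} → (u v : F2Vec n) → _
_≟v_ = ≡-dec B._≟_

Zy : {d ℓ : ℕ} → List (F2Vec d) → F2Vec ℓ → LinMap d ℓ → ℕ
Zy S y h = length (filter (λ u → apply h u ≟v y) S)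

countExceed : (d ℓ : ℕ) → List (F2Vec d) → F2Vec ℓ → ℕ → ℕ
countExceed d ℓ S y r = length (filter (λ h → r <? Zy S y h) (allLinMaps d ℓ))

prodTerm : ℕ → ℕ → ℕ
prodTerm r zero = 1
prodTerm r (suc a) = prodTerm r a * (r + 2 ∸ 2 ^ a)

-- Double counting of the pairs (h, t) with h a linear map and t ∈ Sᵃ a linearly independent
-- tuple with h(tᵢ) = y for all i.
-- If Z_y(h) > r such tuples can be chosen greedily: the span of j chosen entries has 2ʲ
-- elements, one of which is 0 ∉ S, so at least r + 2 − 2ʲ of the more than r vectors of S
-- mapped to y lie outside it; hence h lies in at least ∏ⱼ (r + 2 − 2ʲ) pairs.
-- Conversely, for independent t the tuple (h(t₁), …, h(tₐ)) is uniform on (F₂^ℓ)ᵃ, so t lies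
-- in exactly a 2^(−ℓa) fraction of the maps.  This is proved one row of h at a time, from:
-- if u is outside the span of t, then w ↦ w·u takes both values equally often on the
-- solutions of {w·v = b : v ∈ t}.

module Submission where

open import Defs
open import Algebra.Bundles using (CommutativeMonoid; CommutativeRing)
open import Data.Bool using (Bool; true; false; not; _∧_; _xor_)
open import Data.Bool.Properties
  using (_≟_; ∧-zeroʳ; ∧-distribˡ-xor; not-involutive; ∧-commutativeMonoid; xor-∧-commutativeRing)
open import Data.Empty using (⊥-elim)
open import Data.List using (List; []; _∷_; _++_; [_]; map; concatMap; filter; length)
open import Data.List.Membership.Propositional.Properties
  using (∈-filter⁺; ∈-filter⁻; ∈-++⁺ˡ; ∈-++⁺ʳ; ∈-map⁺)
import Data.List.Membership.DecPropositional as DecMembership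
open import Data.List.Properties using (length-++; length-map; filter-notAll)
open import Data.List.Relation.Binary.Subset.Propositional using (_⊆_)
open import Data.List.Relation.Unary.All using (All)
import Data.List.Relation.Unary.All as All
import Data.List.Relation.Unary.All.Properties as All
open import Data.List.Relation.Unary.AllPairs using ([]; _∷_)
open import Data.List.Relation.Unary.Any using (here; there)
import Data.List.Relation.Unary.Any as Any
open import Data.List.Relation.Unary.Unique.Propositional using (Unique)
import Data.List.Relation.Unary.Unique.Propositional.Properties as Unique
open import Data.Nat using (ℕ; zero; suc; _+_; _*_; _^_; _∸_; _≤_; _<_; _<?_; z≤n; s≤s)
open import Data.Nat.Logarithm using (⌈log₂_⌉)
open import Data.Nat.Properties
  using ( +-identityʳ; +-comm; +-assoc; +-suc; +-mono-≤; +-monoʳ-≤; +-cancelʳ-≡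
        ; *-identityˡ; *-identityʳ; *-zeroʳ; *-comm; *-assoc; *-distribˡ-+; *-distribʳ-+
        ; *-monoʳ-≤; *-monoˡ-≤; *-cancelˡ-≡; ^-*-assoc
        ; ≤-refl; ≤-reflexive; ≤-trans; m≤m+n; m≤n+o⇒m∸n≤o; module ≤-Reasoning
        ; +-commutativeSemigroup; *-commutativeSemigroup )
open import Data.Nat.Tactic.RingSolver using (solve-∀)
open import Data.Product using (_×_; _,_; proj₁; proj₂; uncurry)
open import Data.Vec using (Vec; []; _∷_; replicate; zipWith)
import Data.Vec.Relation.Unary.All as VecAll
open import Function using (_∘_)
open import Level using (Level)
open import Relation.Binary using (DecidableEquality)
open import Relation.Binary.PropositionalEquality hiding ([_])
open import Relation.Nullary using (Dec; yes; no; does; ¬_; ¬?)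
open import Relation.Nullary.Decidable using (map′; _×-dec_; dec-true)
open import Relation.Unary using (Pred; Decidable)

open import Algebra.Properties.CommutativeSemigroup +-commutativeSemigroup
  using () renaming (interchange to +-interchange)
open import Algebra.Properties.CommutativeSemigroup *-commutativeSemigroup
  using () renaming (interchange to *-interchange; x∙yz≈y∙xz to *-swap)
open import Algebra.Properties.CommutativeSemigroup
  (CommutativeMonoid.commutativeSemigroup ∧-commutativeMonoid)
  using () renaming (interchange to ∧-interchange; x∙yz≈y∙xz to ∧-swap)
open import Algebra.Properties.CommutativeSemigroup
  (CommutativeMonoid.commutativeSemigroup (CommutativeRing.+-commutativeMonoid xor-∧-commutativeRing))
  using () renaming (interchange to xor-interchange)

private variable
  A B : Set
  j : ℕ

∑ : (A → ℕ) → List A → ℕ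
∑ f []       = 0
∑ f (x ∷ xs) = f x + ∑ f xs

infix 5 ∑
syntax ∑ (λ x → e) xs = ∑[ x ∈ xs ] e

iverson : Bool → ℕ
iverson false = 0
iverson true  = 1

count : (A → Bool) → List A → ℕ
count p xs = ∑[ x ∈ xs ] iverson (p x)

_≡ᵇ_ : Bool → Bool → Bool
a ≡ᵇ b = does (a ≟ b)

iverson-∧ : ∀ a b → iverson (a ∧ b) ≡ iverson a * iverson b
iverson-∧ false b = refl
iverson-∧ true  b = sym (+-identityʳ (iverson b))

∑-cong : {f g : A → ℕ} → (∀ x → f x ≡ g x) → (xs : List A) → ∑ f xs ≡ ∑ g xs
∑-cong f≗g []       = refl
∑-cong f≗g (x ∷ xs) = cong₂ _+_ (f≗g x) (∑-cong f≗g xs)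

∑-mono-≤ : {f g : A → ℕ} → (∀ x → f x ≤ g x) → (xs : List A) → ∑ f xs ≤ ∑ g xs
∑-mono-≤ f≤g []       = z≤n
∑-mono-≤ f≤g (x ∷ xs) = +-mono-≤ (f≤g x) (∑-mono-≤ f≤g xs)

∑-zero : (xs : List A) → ∑[ x ∈ xs ] 0 ≡ 0
∑-zero []       = refl
∑-zero (x ∷ xs) = ∑-zero xs

∑-const : (c : ℕ) (xs : List A) → ∑[ x ∈ xs ] c ≡ length xs * c
∑-const c []       = refl
∑-const c (x ∷ xs) = cong (c +_) (∑-const c xs)

∑-distrib-+ : (f g : A → ℕ) (xs : List A) → ∑[ x ∈ xs ] (f x + g x) ≡ ∑ f xs + ∑ g xs
∑-distrib-+ f g []       = refl
∑-distrib-+ f g (x ∷ xs) =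
  trans (cong ((f x + g x) +_) (∑-distrib-+ f g xs)) (+-interchange (f x) (g x) (∑ f xs) (∑ g xs))

∑-*ˡ : (c : ℕ) (f : A → ℕ) (xs : List A) → ∑[ x ∈ xs ] (c * f x) ≡ c * ∑ f xs
∑-*ˡ c f []       = sym (*-zeroʳ c)
∑-*ˡ c f (x ∷ xs) = trans (cong (c * f x +_) (∑-*ˡ c f xs)) (sym (*-distribˡ-+ c (f x) (∑ f xs)))

∑-*ʳ : (c : ℕ) (f : A → ℕ) (xs : List A) → ∑[ x ∈ xs ] (f x * c) ≡ ∑ f xs * c
∑-*ʳ c f []       = refl
∑-*ʳ c f (x ∷ xs) = trans (cong (f x * c +_) (∑-*ʳ c f xs)) (sym (*-distribʳ-+ c (f x) (∑ f xs)))

∑-++ : (f : A → ℕ) (xs ys : List A) → ∑ f (xs ++ ys) ≡ ∑ f xs + ∑ f ys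
∑-++ f []       ys = refl
∑-++ f (x ∷ xs) ys = trans (cong (f x +_) (∑-++ f xs ys)) (sym (+-assoc (f x) (∑ f xs) (∑ f ys)))

∑-swap : (F : A → B → ℕ) (xs : List A) (ys : List B) →
         ∑[ x ∈ xs ] ∑[ y ∈ ys ] F x y ≡ ∑[ y ∈ ys ] ∑[ x ∈ xs ] F x y
∑-swap F []       ys = sym (∑-zero ys)
∑-swap F (x ∷ xs) ys = trans (cong (∑ (F x) ys +_) (∑-swap F xs ys))
                             (sym (∑-distrib-+ (F x) (λ y → ∑[ x ∈ xs ] F x y) ys))

∑-concatMap : (f : B → ℕ) (g : A → List B) (xs : List A) →
              ∑ f (concatMap g xs) ≡ ∑[ x ∈ xs ] ∑ f (g x)
∑-concatMap f g []       = refl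
∑-concatMap f g (x ∷ xs) = trans (∑-++ f (g x) (concatMap g xs)) (cong (∑ f (g x) +_) (∑-concatMap f g xs))

∑-map : (f : B → ℕ) (g : A → B) (xs : List A) → ∑ f (map g xs) ≡ ∑[ x ∈ xs ] f (g x)
∑-map f g []       = refl
∑-map f g (x ∷ xs) = cong (f (g x) +_) (∑-map f g xs)

count-cong : {p q : A → Bool} → (∀ x → p x ≡ q x) → (xs : List A) → count p xs ≡ count q xs
count-cong p≗q = ∑-cong (cong iverson ∘ p≗q)

count-true : (xs : List A) → count (λ _ → true) xs ≡ length xs
count-true xs = trans (∑-const 1 xs) (*-identityʳ (length xs))

length-filter≡count : {p : Level} {P : Pred A p} (P? : Decidable P) (xs : List A) →
                      length (filter P? xs) ≡ count (does ∘ P?) xs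
length-filter≡count P? []       = refl
length-filter≡count P? (x ∷ xs) with does (P? x)
... | true  = cong suc (length-filter≡count P? xs)
... | false = length-filter≡count P? xs

count-split : (f p : A → Bool) (xs : List A) →
              count p xs ≡ count (λ x → (f x ≡ᵇ false) ∧ p x) xs + count (λ x → (f x ≡ᵇ true) ∧ p x) xs
count-split f p xs = trans (∑-cong (λ x → split (f x) (p x)) xs) (∑-distrib-+ _ _ xs)
  where
    split : ∀ a b → iverson b ≡ iverson ((a ≡ᵇ false) ∧ b) + iverson ((a ≡ᵇ true) ∧ b)
    split false b = sym (+-identityʳ (iverson b))
    split true  b = refl

count-*-≤-∑ : {p : Level} {P : Pred A p} (P? : Decidable P) {c : ℕ} {f : A → ℕ} →
              (∀ x → P x → c ≤ f x) → (xs : List A) → count (does ∘ P?) xs * c ≤ ∑ f xs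
count-*-≤-∑ P? c≤f []                           = z≤n
count-*-≤-∑ {P = P} P? {c} {f} c≤f (x ∷ xs) = begin
  (iverson (does (P? x)) + count (does ∘ P?) xs) * c
    ≡⟨ *-distribʳ-+ c (iverson (does (P? x))) _ ⟩
  iverson (does (P? x)) * c + count (does ∘ P?) xs * c
    ≤⟨ +-mono-≤ (head≤ (P? x)) (count-*-≤-∑ P? c≤f xs) ⟩
  f x + ∑ f xs
    ∎
  where
    open ≤-Reasoning
    head≤ : (Px? : Dec (P x)) → iverson (does Px?) * c ≤ f x
    head≤ (yes Px) = ≤-trans (≤-reflexive (+-identityʳ c)) (c≤f x Px)
    head≤ (no _)   = z≤n

∑-allVecsOf-suc : (xs : List A) (n : ℕ) (f : Vec A (suc n) → ℕ) →
                  ∑ f (allVecsOf xs (suc n)) ≡ ∑[ v ∈ allVecsOf xs n ] ∑[ x ∈ xs ] f (x ∷ v)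
∑-allVecsOf-suc xs n f =
  trans (∑-concatMap f _ (allVecsOf xs n)) (∑-cong (λ v → ∑-map f (_∷ v) xs) (allVecsOf xs n))

count-allVecsOf-suc : (xs : List A) (n : ℕ) {r : Vec A (suc n) → Bool}
                      (p : Vec A n → A → Bool) (q : Vec A n → Bool) →
                      (∀ x v → r (x ∷ v) ≡ p v x ∧ q v) →
                      count r (allVecsOf xs (suc n)) ≡ ∑[ v ∈ allVecsOf xs n ] count (p v) xs * iverson (q v)
count-allVecsOf-suc xs n {r} p q r≡p∧q = trans (∑-allVecsOf-suc xs n _) (∑-cong factor (allVecsOf xs n))
  where
    factor : ∀ v → count (λ x → r (x ∷ v)) xs ≡ count (p v) xs * iverson (q v)
    factor v = trans (∑-cong (λ x → trans (cong iverson (r≡p∧q x v)) (iverson-∧ (p v x) (q v))) xs)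
                     (∑-*ʳ (iverson (q v)) (iverson ∘ p v) xs)

length-allVecsOf : (xs : List A) (n : ℕ) → length (allVecsOf xs n) ≡ length xs ^ n
length-allVecsOf xs zero    = refl
length-allVecsOf xs (suc n) = begin
  length (allVecsOf xs (suc n))                   ≡⟨ sym (count-true (allVecsOf xs (suc n))) ⟩
  count (λ _ → true) (allVecsOf xs (suc n))       ≡⟨ ∑-allVecsOf-suc xs n _ ⟩
  ∑[ v ∈ allVecsOf xs n ] count (λ _ → true) xs   ≡⟨ ∑-cong (λ _ → count-true xs) (allVecsOf xs n) ⟩
  ∑[ v ∈ allVecsOf xs n ] length xs               ≡⟨ ∑-const (length xs) (allVecsOf xs n) ⟩
  length (allVecsOf xs n) * length xs             ≡⟨ cong (_* length xs) (length-allVecsOf xs n) ⟩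
  length xs ^ n * length xs                       ≡⟨ *-comm (length xs ^ n) (length xs) ⟩
  length xs ^ suc n                               ∎
  where open ≡-Reasoning

square-balanced : ∀ {a b c e} → a + c ≡ b + e → a + e ≡ b + c → a ≡ b × c ≡ e
square-balanced {a} {b} {c} {e} column diagonal =
  +-cancelʳ-≡ c a b (trans column (cong (b +_) (sym c≡e))) , c≡e
  where
    regroup : ∀ x y z → (x + z) + (y + z) ≡ 2 * z + (x + y)
    regroup = solve-∀
    c≡e : c ≡ e
    c≡e = *-cancelˡ-≡ c e 2 (+-cancelʳ-≡ (a + b) (2 * c) (2 * e) (begin
      2 * c + (a + b)   ≡⟨ regroup a b c ⟨
      (a + c) + (b + c) ≡⟨ cong₂ _+_ column (sym diagonal) ⟩
      (b + e) + (a + e) ≡⟨ regroup b a e ⟩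
      2 * e + (b + a)   ≡⟨ cong (2 * e +_) (+-comm b a) ⟩
      2 * e + (a + b)   ∎))
      where open ≡-Reasoning

Balanced : List A → (A → Bool) → (A → Bool) → Set
Balanced xs p f = count (λ x → (f x ≡ᵇ false) ∧ p x) xs ≡ count (λ x → (f x ≡ᵇ true) ∧ p x) xs

module _ (xs : List A) (p : A → Bool) where

  balanced⇒halves : (f : A → Bool) → Balanced xs p f →
                    ∀ c → 2 * count (λ x → (f x ≡ᵇ c) ∧ p x) xs ≡ count p xs
  balanced⇒halves f balanced c = trans (double c) (sym (count-split f p xs))
    where
      F : Bool → ℕ
      F c = count (λ x → (f x ≡ᵇ c) ∧ p x) xs
      double : ∀ c → 2 * F c ≡ F false + F true
      double false = cong (F false +_) (trans (+-identityʳ (F false)) balanced)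
      double true  = trans (cong (F true +_) (+-identityʳ (F true))) (cong (_+ F true) (sym balanced))

  balanced-resp : {f g : A → Bool} → (∀ x → f x ≡ g x) → Balanced xs p f → Balanced xs p g
  balanced-resp f≗g balanced =
    trans (count-cong (λ x → cong (λ b → (b ≡ᵇ false) ∧ p x) (sym (f≗g x))) xs)
          (trans balanced (count-cong (λ x → cong (λ b → (b ≡ᵇ true) ∧ p x) (f≗g x)) xs))

  -- With N α β the number of x satisfying p with f x = α and g x = β, balance of g and of
  -- f xor g read N₀₀ + N₁₀ = N₀₁ + N₁₁ and N₀₀ + N₁₁ = N₀₁ + N₁₀, whence N α 0 = N α 1.
  balanced-fibres : (f g : A → Bool) → Balanced xs p g → Balanced xs p (λ x → f x xor g x) →
                    ∀ α → Balanced xs (λ x → (f x ≡ᵇ α) ∧ p x) g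
  balanced-fibres f g g-balanced f⊕g-balanced α = fibre α
    where
      N : Bool → Bool → ℕ
      N α β = count (λ x → (g x ≡ᵇ β) ∧ ((f x ≡ᵇ α) ∧ p x)) xs

      column : ∀ β → count (λ x → (g x ≡ᵇ β) ∧ p x) xs ≡ N false β + N true β
      column β = trans (count-split f _ xs)
        (cong₂ _+_ (count-cong (λ x → ∧-swap (f x ≡ᵇ false) (g x ≡ᵇ β) (p x)) xs)
                   (count-cong (λ x → ∧-swap (f x ≡ᵇ true) (g x ≡ᵇ β) (p x)) xs))

      xor-cell : ∀ a b α γ c →
                 (a ≡ᵇ α) ∧ (((a xor b) ≡ᵇ γ) ∧ c) ≡ (b ≡ᵇ (α xor γ)) ∧ ((a ≡ᵇ α) ∧ c)
      xor-cell false b false γ c = refl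
      xor-cell false b true  γ c = sym (∧-zeroʳ _)
      xor-cell true  b false γ c = sym (∧-zeroʳ _)
      xor-cell true  b true  γ c = cong (_∧ c) (not-≡ᵇ b γ)
        where
          not-≡ᵇ : ∀ b γ → (not b ≡ᵇ γ) ≡ (b ≡ᵇ not γ)
          not-≡ᵇ false false = refl
          not-≡ᵇ false true  = refl
          not-≡ᵇ true  false = refl
          not-≡ᵇ true  true  = refl

      diagonal : ∀ γ → count (λ x → ((f x xor g x) ≡ᵇ γ) ∧ p x) xs ≡ N false γ + N true (not γ)
      diagonal γ = trans (count-split f _ xs)
        (cong₂ _+_ (count-cong (λ x → xor-cell (f x) (g x) false γ (p x)) xs)
                   (count-cong (λ x → xor-cell (f x) (g x) true γ (p x)) xs))

      cells : N false false ≡ N false true × N true false ≡ N true true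
      cells = square-balanced (trans (sym (column false)) (trans g-balanced (column true)))
                              (trans (sym (diagonal false)) (trans f⊕g-balanced (diagonal true)))

      fibre : ∀ α → N α false ≡ N α true
      fibre false = proj₁ cells
      fibre true  = proj₂ cells

module _ (_≟ᴬ_ : DecidableEquality A) where
  open DecMembership _≟ᴬ_ using (_∈_; _∈?_)

  unique-⊆⇒length≤ : {xs ys : List A} → Unique xs → xs ⊆ ys → length xs ≤ length ys
  unique-⊆⇒length≤ []                     _     = z≤n
  unique-⊆⇒length≤ {x ∷ xs} {ys} (x∉xs ∷ !xs) x∷xs⊆ys = begin-strict
    length xs              ≤⟨ unique-⊆⇒length≤ !xs xs⊆others ⟩
    length (filter ≢x? ys) <⟨ filter-notAll ≢x? ys (Any.map (λ x≡y x≢y → x≢y x≡y) (x∷xs⊆ys (here refl))) ⟩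
    length ys              ∎
    where
      open ≤-Reasoning
      ≢x? : Decidable (λ y → ¬ x ≡ y)
      ≢x? y = ¬? (x ≟ᴬ y)
      xs⊆others : xs ⊆ filter ≢x? ys
      xs⊆others y∈xs = ∈-filter⁺ ≢x? (x∷xs⊆ys (there y∈xs)) (All.lookup x∉xs y∈xs)

  count-∈<length : {z : A} {S L : List A} → Unique S → All (_≢ z) S → z ∈ L →
                   count (λ x → does (x ∈? L)) S < length L
  count-∈<length {z} {S} {L} !S S≢z z∈L = begin
    suc (count (λ x → does (x ∈? L)) S) ≡⟨ cong suc (length-filter≡count (_∈? L) S) ⟨
    length (z ∷ filter (_∈? L) S)       ≤⟨ unique-⊆⇒length≤ !z∷S∩L z∷S∩L⊆L ⟩
    length L                            ∎
    where
      open ≤-Reasoning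
      !z∷S∩L : Unique (z ∷ filter (_∈? L) S)
      !z∷S∩L = All.filter⁺ (_∈? L) (All.map ≢-sym S≢z) ∷ Unique.filter⁺ (_∈? L) !S
      z∷S∩L⊆L : z ∷ filter (_∈? L) S ⊆ L
      z∷S∩L⊆L (here refl) = z∈L
      z∷S∩L⊆L (there x∈)  = proj₂ (∈-filter⁻ (_∈? L) {xs = S} x∈)

  count-∉-≥ : {z : A} {S L : List A} (q : A → Bool) {r : ℕ} → Unique S → All (_≢ z) S → z ∈ L →
              r < count q S → r + 2 ∸ length L ≤ count (λ x → not (does (x ∈? L)) ∧ q x) S
  count-∉-≥ {S = S} {L} q {r} !S S≢z z∈L r<q = m≤n+o⇒m∸n≤o (r + 2) (length L) (begin
    r + 2             ≡⟨ +-comm r 2 ⟩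
    suc (suc r)       ≤⟨ s≤s r<q ⟩
    suc (count q S)   ≤⟨ s≤s (∑-mono-≤ (λ x → split (does (x ∈? L)) (q x)) S) ⟩
    suc (∑[ x ∈ S ] (iverson (not (does (x ∈? L)) ∧ q x) + iverson (does (x ∈? L))))
                      ≡⟨ cong suc (∑-distrib-+ _ _ S) ⟩
    suc (X + Y)       ≡⟨ +-suc X Y ⟨
    X + suc Y         ≤⟨ +-monoʳ-≤ X (count-∈<length !S S≢z z∈L) ⟩
    X + length L      ≡⟨ +-comm X (length L) ⟩
    length L + X      ∎)
    where
      open ≤-Reasoning
      X = count (λ x → not (does (x ∈? L)) ∧ q x) S
      Y = count (λ x → does (x ∈? L)) S
      split : ∀ m b → iverson b ≤ iverson (not m ∧ b) + iverson m
      split false b     = m≤m+n (iverson b) 0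
      split true  false = z≤n
      split true  true  = ≤-refl

0ᵛ : {d : ℕ} → F2Vec d
0ᵛ = replicate _ false

_⊕_ : {d : ℕ} → F2Vec d → F2Vec d → F2Vec d
_⊕_ = zipWith _xor_

⊕-cancelˡ : {d : ℕ} (v u : F2Vec d) → v ⊕ (v ⊕ u) ≡ u
⊕-cancelˡ []      []      = refl
⊕-cancelˡ (x ∷ v) (y ∷ u) = cong₂ _∷_ (xor-cancelˡ x y) (⊕-cancelˡ v u)
  where
    xor-cancelˡ : ∀ x y → x xor (x xor y) ≡ y
    xor-cancelˡ false y = refl
    xor-cancelˡ true  y = not-involutive y

dot-⊕ : {d : ℕ} (w v u : F2Vec d) → dot w (v ⊕ u) ≡ dot w v xor dot w u
dot-⊕ []      []      []      = refl
dot-⊕ (c ∷ w) (x ∷ v) (y ∷ u) = begin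
  (c ∧ (x xor y)) xor dot w (v ⊕ u)               ≡⟨ cong₂ _xor_ (∧-distribˡ-xor c x y) (dot-⊕ w v u) ⟩
  ((c ∧ x) xor (c ∧ y)) xor (dot w v xor dot w u) ≡⟨ xor-interchange (c ∧ x) (c ∧ y) (dot w v) (dot w u) ⟩
  ((c ∧ x) xor dot w v) xor ((c ∧ y) xor dot w u) ∎
  where open ≡-Reasoning

length-allF2Vecs : (d : ℕ) → length (allF2Vecs d) ≡ 2 ^ d
length-allF2Vecs = length-allVecsOf (false ∷ true ∷ [])

dot-balanced : {d : ℕ} {u : F2Vec d} → u ≢ 0ᵛ → Balanced (allF2Vecs d) (λ _ → true) (λ w → dot w u)
dot-balanced {u = []}    u≢0 = ⊥-elim (u≢0 refl)
dot-balanced {suc d} {u = true ∷ u} _ =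
  trans (∑-allVecsOf-suc _ d _)
        (trans (∑-cong (λ w → complementary (dot w u)) (allF2Vecs d)) (sym (∑-allVecsOf-suc _ d _)))
  where
    complementary : ∀ D → count (λ c → (c ≡ᵇ false) ∧ true) (D ∷ not D ∷ []) ≡
                          count (λ c → (c ≡ᵇ true) ∧ true) (D ∷ not D ∷ [])
    complementary false = refl
    complementary true  = refl
dot-balanced {suc d} {u = false ∷ u} u≢0 = begin
  count (λ w → (dot w (false ∷ u) ≡ᵇ false) ∧ true) (allF2Vecs (suc d))
    ≡⟨ doubled false ⟩
  2 * count (λ w → (dot w u ≡ᵇ false) ∧ true) (allF2Vecs d)
    ≡⟨ cong (2 *_) (dot-balanced (u≢0 ∘ cong (false ∷_))) ⟩
  2 * count (λ w → (dot w u ≡ᵇ true) ∧ true) (allF2Vecs d)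
    ≡⟨ doubled true ⟨
  count (λ w → (dot w (false ∷ u) ≡ᵇ true) ∧ true) (allF2Vecs (suc d))
    ∎
  where
    open ≡-Reasoning
    doubled : ∀ c → count (λ w → (dot w (false ∷ u) ≡ᵇ c) ∧ true) (allF2Vecs (suc d)) ≡
                    2 * count (λ w → (dot w u ≡ᵇ c) ∧ true) (allF2Vecs d)
    doubled c = trans (∑-allVecsOf-suc _ d _) (∑-*ˡ 2 (λ w → iverson ((dot w u ≡ᵇ c) ∧ true)) (allF2Vecs d))

module _ {d : ℕ} where
  open DecMembership (_≟v_ {d}) using (_∈_; _∉_; _∈?_)

  -- All 2ʲ subset sums of t, repeated when t is dependent.
  span : Vec (F2Vec d) j → List (F2Vec d)
  span []      = [ 0ᵛ ]
  span (v ∷ t) = span t ++ map (v ⊕_) (span t)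

  length-span : (t : Vec (F2Vec d) j) → length (span t) ≡ 2 ^ j
  length-span []              = refl
  length-span {suc j} (v ∷ t) = begin
    length (span t ++ map (v ⊕_) (span t))        ≡⟨ length-++ (span t) ⟩
    length (span t) + length (map (v ⊕_) (span t)) ≡⟨ cong (length (span t) +_) (length-map (v ⊕_) (span t)) ⟩
    length (span t) + length (span t)              ≡⟨ cong (λ n → n + n) (length-span t) ⟩
    2 ^ j + 2 ^ j                                  ≡⟨ cong (2 ^ j +_) (+-identityʳ (2 ^ j)) ⟨
    2 ^ suc j                                      ∎
    where open ≡-Reasoning

  0ᵛ∈span : (t : Vec (F2Vec d) j) → 0ᵛ ∈ span t
  0ᵛ∈span []      = here refl
  0ᵛ∈span (v ∷ t) = ∈-++⁺ˡ (0ᵛ∈span t)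

  ∉span-∷⁻ : {v u : F2Vec d} {t : Vec (F2Vec d) j} → u ∉ span (v ∷ t) → u ∉ span t × v ⊕ u ∉ span t
  ∉span-∷⁻ {v = v} {u} {t} u∉ =
    u∉ ∘ ∈-++⁺ˡ ,
    u∉ ∘ ∈-++⁺ʳ (span t) ∘ subst (_∈ map (v ⊕_) (span t)) (⊕-cancelˡ v u) ∘ ∈-map⁺ (v ⊕_)

  data Independent : {j : ℕ} → Vec (F2Vec d) j → Set where
    []  : Independent []
    _∷_ : {j : ℕ} {v : F2Vec d} {t : Vec (F2Vec d) j} → v ∉ span t → Independent t → Independent (v ∷ t)

  independent? : (t : Vec (F2Vec d) j) → Dec (Independent t)
  independent? []      = yes []
  independent? (v ∷ t) =
    map′ (uncurry _∷_) (λ { (v∉ ∷ ind) → v∉ , ind }) (¬? (v ∈? span t) ×-dec independent? t)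

  solves : F2Vec d → Vec (F2Vec d) j → Bool → Bool
  solves w t b = does (VecAll.all? (λ v → dot w v ≟ b) t)

  solves-balanced : {t : Vec (F2Vec d) j} {u : F2Vec d} → u ∉ span t → ∀ b →
                    Balanced (allF2Vecs d) (λ w → solves w t b) (λ w → dot w u)
  solves-balanced {t = []}    u∉ b = dot-balanced (u∉ ∘ here)
  solves-balanced {t = v ∷ t} {u} u∉ b =
    balanced-fibres (allF2Vecs d) (λ w → solves w t b) (λ w → dot w v) (λ w → dot w u)
      (solves-balanced {t = t} u∉t b)
      (balanced-resp (allF2Vecs d) (λ w → solves w t b) (λ w → dot-⊕ w v u) (solves-balanced {t = t} v⊕u∉t b))
      b
    where
      u∉t×v⊕u∉t = ∉span-∷⁻ {t = t} u∉
      u∉t = proj₁ u∉t×v⊕u∉t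
      v⊕u∉t = proj₂ u∉t×v⊕u∉t

  solves-count : {t : Vec (F2Vec d) j} → Independent t → ∀ b →
                 2 ^ j * count (λ w → solves w t b) (allF2Vecs d) ≡ 2 ^ d
  solves-count []                         b =
    trans (*-identityˡ _) (trans (count-true (allF2Vecs d)) (length-allF2Vecs d))
  solves-count {suc j} {v ∷ t} (v∉ ∷ ind) b = begin
    2 ^ suc j * count (λ w → solves w (v ∷ t) b) (allF2Vecs d)             ≡⟨ *-assoc 2 (2 ^ j) _ ⟩
    2 * (2 ^ j * count (λ w → solves w (v ∷ t) b) (allF2Vecs d))           ≡⟨ *-swap 2 (2 ^ j) _ ⟩
    2 ^ j * (2 * count (λ w → (dot w v ≡ᵇ b) ∧ solves w t b) (allF2Vecs d)) ≡⟨ cong (2 ^ j *_) halves ⟩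
    2 ^ j * count (λ w → solves w t b) (allF2Vecs d)                       ≡⟨ solves-count ind b ⟩
    2 ^ d                                                                  ∎
    where
      open ≡-Reasoning
      halves = balanced⇒halves (allF2Vecs d) (λ w → solves w t b) (λ w → dot w v) (solves-balanced {t = t} v∉ b) b

  sends : {ℓ : ℕ} → LinMap d ℓ → Vec (F2Vec d) j → F2Vec ℓ → Bool
  sends h t y = does (VecAll.all? (λ v → apply h v ≟v y) t)

  sends-∷ : {ℓ : ℕ} (w : F2Vec d) (M : LinMap d ℓ) (t : Vec (F2Vec d) j) (b : Bool) (y : F2Vec ℓ) →
            sends (w ∷ M) t (b ∷ y) ≡ solves w t b ∧ sends M t y
  sends-∷ w M []      b y = refl
  sends-∷ w M (v ∷ t) b y =
    trans (cong ((dot w v ≡ᵇ b ∧ does (apply M v ≟v y)) ∧_) (sends-∷ w M t b y))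
          (∧-interchange (dot w v ≡ᵇ b) (does (apply M v ≟v y)) (solves w t b) (sends M t y))

  sends-count : {t : Vec (F2Vec d) j} → Independent t → (ℓ : ℕ) (y : F2Vec ℓ) →
                (2 ^ j) ^ ℓ * count (λ h → sends h t y) (allLinMaps d ℓ) ≡ (2 ^ d) ^ ℓ
  sends-count {t = t} ind zero    [] =
    cong (λ b → (iverson b + 0) + 0) (dec-true (VecAll.all? _ t) (VecAll.universal (λ _ → refl) t))
  sends-count {j} {t} ind (suc ℓ) (b ∷ y) = begin
    (2 ^ j) ^ suc ℓ * count (λ h → sends h t (b ∷ y)) (allLinMaps d (suc ℓ))
      ≡⟨ cong ((2 ^ j) ^ suc ℓ *_) rows ⟩
    (2 ^ j * (2 ^ j) ^ ℓ) * (count (λ w → solves w t b) (allF2Vecs d) * count (λ h → sends h t y) (allLinMaps d ℓ))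
      ≡⟨ *-interchange (2 ^ j) ((2 ^ j) ^ ℓ) _ _ ⟩
    (2 ^ j * count (λ w → solves w t b) (allF2Vecs d)) * ((2 ^ j) ^ ℓ * count (λ h → sends h t y) (allLinMaps d ℓ))
      ≡⟨ cong₂ _*_ (solves-count ind b) (sends-count ind ℓ y) ⟩
    2 ^ d * (2 ^ d) ^ ℓ ∎
    where
      open ≡-Reasoning
      rows : count (λ h → sends h t (b ∷ y)) (allLinMaps d (suc ℓ)) ≡
             count (λ w → solves w t b) (allF2Vecs d) * count (λ h → sends h t y) (allLinMaps d ℓ)
      rows = trans
        (count-allVecsOf-suc (allF2Vecs d) ℓ (λ _ w → solves w t b) (λ M → sends M t y) (λ w M → sends-∷ w M t b y))
        (∑-*ˡ (count (λ w → solves w t b) (allF2Vecs d)) (λ M → iverson (sends M t y)) (allLinMaps d ℓ))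

  independentAll : {Q : F2Vec d → Set} → Decidable Q → Vec (F2Vec d) j → Bool
  independentAll Q? t = does (independent? t) ∧ does (VecAll.all? Q? t)

  count-independentAll-tuples-≥ : {S : List (F2Vec d)} → Unique S → All (_≢ 0ᵛ) S →
                           {Q : F2Vec d → Set} (Q? : Decidable Q) {r : ℕ} → r < length (filter Q? S) →
                           (j : ℕ) → prodTerm r j ≤ count (independentAll Q?) (allVecsOf S j)
  count-independentAll-tuples-≥ !S S≢0 Q? r<Q zero = ≤-refl
  count-independentAll-tuples-≥ {S} !S S≢0 Q? {r} r<Q (suc j) = begin
    prodTerm r j * c
      ≤⟨ *-monoˡ-≤ c (count-independentAll-tuples-≥ !S S≢0 Q? r<Q j) ⟩
    count (independentAll Q?) (allVecsOf S j) * c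
      ≡⟨ ∑-*ʳ c (iverson ∘ independentAll Q?) (allVecsOf S j) ⟨
    ∑[ t ∈ allVecsOf S j ] iverson (independentAll Q? t) * c
      ≤⟨ ∑-mono-≤ (λ t → ≤-trans (≤-reflexive (*-comm _ c)) (*-monoˡ-≤ _ (fresh t))) (allVecsOf S j) ⟩
    ∑[ t ∈ allVecsOf S j ] count (extends t) S * iverson (independentAll Q? t)
      ≡⟨ count-allVecsOf-suc S j extends (independentAll Q?) independentAll-∷ ⟨
    count (independentAll Q?) (allVecsOf S (suc j)) ∎
    where
      open ≤-Reasoning
      c = r + 2 ∸ 2 ^ j
      extends : Vec (F2Vec d) j → F2Vec d → Bool
      extends t v = not (does (v ∈? span t)) ∧ does (Q? v)
      independentAll-∷ : ∀ v t → independentAll Q? (v ∷ t) ≡ extends t v ∧ independentAll Q? t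
      independentAll-∷ v t =
        ∧-interchange (not (does (v ∈? span t))) (does (independent? t)) (does (Q? v)) (does (VecAll.all? Q? t))
      fresh : ∀ t → c ≤ count (extends t) S
      fresh t = subst (λ n → r + 2 ∸ n ≤ count (extends t) S) (length-span t)
        (count-∉-≥ _≟v_ (does ∘ Q?) !S S≢0 (0ᵛ∈span t) (subst (r <_) (length-filter≡count Q? S) r<Q))

  length-allLinMaps : (ℓ : ℕ) → length (allLinMaps d ℓ) ≡ (2 ^ d) ^ ℓ
  length-allLinMaps ℓ = trans (length-allVecsOf (allF2Vecs d) ℓ) (cong (_^ ℓ) (length-allF2Vecs d))

  count-independentAll-maps-≤ : {ℓ : ℕ} (t : Vec (F2Vec d) j) (y : F2Vec ℓ) →
                                (2 ^ ℓ) ^ j * count (λ h → independentAll (λ v → apply h v ≟v y) t) (allLinMaps d ℓ)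
                                  ≤ length (allLinMaps d ℓ)
  count-independentAll-maps-≤ {j} {ℓ} t y with independent? t
  ... | yes ind = ≤-reflexive (begin
    (2 ^ ℓ) ^ j * count (λ h → sends h t y) (allLinMaps d ℓ)
      ≡⟨ cong (_* count (λ h → sends h t y) (allLinMaps d ℓ)) power-swap ⟩
    (2 ^ j) ^ ℓ * count (λ h → sends h t y) (allLinMaps d ℓ)
      ≡⟨ sends-count ind ℓ y ⟩
    (2 ^ d) ^ ℓ
      ≡⟨ length-allLinMaps ℓ ⟨
    length (allLinMaps d ℓ)
      ∎)
    where
      open ≡-Reasoning
      power-swap : (2 ^ ℓ) ^ j ≡ (2 ^ j) ^ ℓ
      power-swap = trans (^-*-assoc 2 ℓ j) (trans (cong (2 ^_) (*-comm ℓ j)) (sym (^-*-assoc 2 j ℓ)))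
  ... | no _ =
    ≤-trans (≤-reflexive (trans (cong ((2 ^ ℓ) ^ j *_) (∑-zero (allLinMaps d ℓ))) (*-zeroʳ ((2 ^ ℓ) ^ j)))) z≤n

  countExceed-bound : {ℓ : ℕ} {S : List (F2Vec d)} → Unique S → All (_≢ 0ᵛ) S →
                      (y : F2Vec ℓ) (r a : ℕ) →
                      countExceed d ℓ S y r * ((2 ^ ℓ) ^ a * prodTerm r a)
                        ≤ length S ^ a * length (allLinMaps d ℓ)
  countExceed-bound {ℓ} {S} !S S≢0 y r a = begin
    E * (K * prodTerm r a)
      ≡⟨ *-swap E K (prodTerm r a) ⟩
    K * (E * prodTerm r a)
      ≤⟨ *-monoʳ-≤ K exceeding ⟩
    K * (∑[ h ∈ H ] count (good h) tuples)
      ≡⟨ cong (K *_) (∑-swap (λ h t → iverson (good h t)) H tuples) ⟩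
    K * (∑[ t ∈ tuples ] count (λ h → good h t) H)
      ≡⟨ ∑-*ˡ K (λ t → count (λ h → good h t) H) tuples ⟨
    ∑[ t ∈ tuples ] K * count (λ h → good h t) H
      ≤⟨ ∑-mono-≤ (λ t → count-independentAll-maps-≤ t y) tuples ⟩
    ∑[ t ∈ tuples ] length H
      ≡⟨ ∑-const (length H) tuples ⟩
    length tuples * length H
      ≡⟨ cong (_* length H) (length-allVecsOf S a) ⟩
    length S ^ a * length H
      ∎
    where
      open ≤-Reasoning
      E = countExceed d ℓ S y r
      K = (2 ^ ℓ) ^ a
      H = allLinMaps d ℓ
      tuples = allVecsOf S a
      good : LinMap d ℓ → Vec (F2Vec d) a → Bool
      good h = independentAll (λ v → apply h v ≟v y)
      exceeding : E * prodTerm r a ≤ ∑[ h ∈ H ] count (good h) tuples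
      exceeding = ≤-trans (≤-reflexive (cong (_* prodTerm r a) (length-filter≡count (λ h → r <? Zy S y h) H)))
        (count-*-≤-∑ (λ h → r <? Zy S y h)
                     (λ h r<Zy → count-independentAll-tuples-≥ !S S≢0 (λ v → apply h v ≟v y) r<Zy a) H)

theoremB1 : (d ℓ : ℕ) (S : List (F2Vec d)) → Unique S → All (λ u → u ≢ replicate d false) S →
    (y : F2Vec ℓ) (r : ℕ) →
    countExceed d ℓ S y r * ((2 ^ ℓ) ^ ⌈log₂ (r + 2) ⌉ * prodTerm r ⌈log₂ (r + 2) ⌉)
      ≤ length S ^ ⌈log₂ (r + 2) ⌉ * length (allLinMaps d ℓ)
theoremB1 d ℓ S !S S≢0 y r = countExceed-bound !S S≢0 y r ⌈log₂ (r + 2) ⌉
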